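{- Let $\{U_0,U_1,U_2,U_3\}$ be a partition of the vertex set of the Shrikhande graph into four pairwise disjoint cocliques. Then there exists exactly one set $\{\tau_1,\tau_2,\tau_3\}$ of three automorphisms of the Shrikhande graph such that for every $j\in\{0,1,2,3\}$, every $i\in\{1,2,3\}$ and every vertex $s$: (1) if $s\in U_j$ then $\tau_i(s)\in U_j$; (2) $d(\tau_i(s),s)=2$; (3) $d(\tau_i(s),\tau_{i'}(s))=2$ for all $i'\in\{1,2,3\}$ with $i'\ne i$.
   Context: The Shrikhande graph is the Cayley graph on $\mathbb{Z}_4^2$ with connection set $\{01,03,10,30,11,33\}$; $d$ denotes graph distance in it. A coclique is a maximum independent set (of size $4$). -}

module Defs where

open import Data.Nat using (ℕ; _+_; _∸_)
open import Data.Nat.DivMod using (_mod_)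
open import Data.Fin using (Fin; toℕ)
open import Data.Fin.Patterns
open import Data.Product using (_×_; _,_; ∃; ∃-syntax; Σ)
open import Data.List using (List; _∷_; []; allFin; cartesianProduct; filter; length)
open import Data.List.Membership.Propositional using (_∈_)
open import Relation.Binary.PropositionalEquality using (_≡_; _≢_)
open import Relation.Nullary using (¬_)
open import Function.Bundles using (_⇔_)
open import Function.Definitions using (Bijective)
open import Data.Fin using (_≟_)

-- Vertices of the Shrikhande graph: ℤ₄ × ℤ₄.
Vertex : Set
Vertex = Fin 4 × Fin 4

_⊖_ : Fin 4 → Fin 4 → Fin 4
a ⊖ b = ((4 + toℕ a) ∸ toℕ b) mod 4

ConnSet : List Vertex
ConnSet = (0F , 1F) ∷ (0F , 3F) ∷ (1F , 0F) ∷ (3F , 0F) ∷ (1F , 1F) ∷ (3F , 3F) ∷ []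

Adj : Vertex → Vertex → Set
Adj (x₁ , x₂) (y₁ , y₂) = (y₁ ⊖ x₁ , y₂ ⊖ x₂) ∈ ConnSet

Dist2 : Vertex → Vertex → Set
Dist2 x y = x ≢ y × ¬ Adj x y × ∃[ z ] (Adj x z × Adj z y)

record Aut : Set where
  field
    fun       : Vertex → Vertex
    bijective : Bijective _≡_ _≡_ fun
    preserves : ∀ x y → Adj x y ⇔ Adj (fun x) (fun y)
open Aut public

allVertices : List Vertex
allVertices = cartesianProduct (allFin 4) (allFin 4)

-- a partition of the vertex set into four classes U₀..U₃, given by a labelling
-- U : Vertex → Fin 4 (U_j = fibre over j). Each class is a coclique:
-- an independent set of size 4.
IsIndependentClass : (Vertex → Fin 4) → Fin 4 → Set
IsIndependentClass U j = ∀ x y → U x ≡ j → U y ≡ j → ¬ Adj x y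

classSize : (Vertex → Fin 4) → Fin 4 → ℕ
classSize U j = length (filter (λ v → U v ≟ j) allVertices)

IsCocliquePartition : (Vertex → Fin 4) → Set
IsCocliquePartition U = ∀ j → IsIndependentClass U j × classSize U j ≡ 4

Good : (Vertex → Fin 4) → (Fin 3 → Aut) → Set
Good U τ = ∀ i s →
    U (fun (τ i) s) ≡ U s
  × Dist2 (fun (τ i) s) s
  × (∀ i' → i' ≢ i → Dist2 (fun (τ i) s) (fun (τ i') s))

-- the sets {σ₁,σ₂,σ₃} and {τ₁,τ₂,τ₃} coincide (automorphisms compared pointwise)
SameSet : (Fin 3 → Aut) → (Fin 3 → Aut) → Set
SameSet σ τ = (∀ i → ∃[ j ] (∀ s → fun (σ i) s ≡ fun (τ j) s))
            × (∀ j → ∃[ i ] (∀ s → fun (τ j) s ≡ fun (σ i) s))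

module Submission where

-- Every proper 4-colouring of the Shrikhande graph, in particular every partition into
-- cocliques, has the same classes as one of ten labellings
-- `partition k`; this is an exhaustive search over colourings extended vertex by vertex.
-- For each of the ten, three affine maps x ↦ Ax + t of ℤ₄² are automorphisms satisfying
-- (1)–(3). Conversely, by (1) and (2) each σᵢ of another such triple preserves every class
-- and fixes no vertex, and a second exhaustive search, over adjacency-preserving maps with
-- these properties, shows that it is one of the three affine maps. By (3) distinct σᵢ are
-- distinct maps, so this matching is a permutation of Fin 3.

open import Defs
open import Data.Fin using (Fin)
open import Data.Product using (_×_; ∃-syntax)

open import Data.Bool using (true)
open import Data.Empty using (⊥-elim)
open import Data.Fin using (toℕ; _≟_; punchOut)
open import Data.Fin.Patterns
open import Data.Fin.Properties using (any?; all?; punchOut-injective; <⇒notInjective)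
open import Data.List using (List; []; _∷_; [_]; map; concatMap; filter; allFin)
open import Data.List.Membership.DecPropositional using (_∈?_)
open import Data.List.Membership.Propositional using (_∈_)
open import Data.List.Membership.Propositional.Properties
  using (∈-map⁺; ∈-concatMap⁺; ∈-filter⁺; ∈-allFin; ∈-cartesianProduct⁺)
open import Data.List.Relation.Unary.All as All using (All)
open import Data.List.Relation.Unary.All.Properties using (map⁺)
open import Data.List.Relation.Unary.Any as Any using (here)
open import Data.Nat using (suc; _+_; _*_)
open import Data.Nat.DivMod using (_mod_)
open import Data.Nat.Properties using (n<1+n)
open import Data.Product using (_,_; proj₁; proj₂)
open import Data.Product.Properties using (≡-dec)
open import Data.Unit using (tt)
open import Data.Vec using (Vec; []; _∷_; lookup)
open import Function.Base using (_∘_)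
open import Function.Bundles using (_⇔_; mk⇔; Equivalence)
open import Function.Consequences.Propositional using (strictlySurjective⇒surjective)
open import Function.Definitions using (Injective; StrictlySurjective)
open import Relation.Binary.Definitions using (DecidableEquality)
open import Relation.Binary.PropositionalEquality
  using (_≡_; _≢_; refl; sym; trans; cong; subst; _≗_; module ≡-Reasoning)
open import Relation.Nullary using (Dec; yes; no; ¬?)
open import Relation.Nullary.Decidable using (map′; _×-dec_; _→-dec_; does; proof)
open import Relation.Nullary.Reflects using (Reflects; invert)

-- Type checking `refl : does a? ≡ true` runs a? in Agda's fast evaluator; going through
-- `T (does a?)` (as `from-yes` and `toWitness` do) is an order of magnitude slower here.
byEvaluation : {A : Set} (a? : Dec A) → does a? ≡ true → A
byEvaluation a? does≡true = invert (subst (Reflects _) does≡true (proof a?))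

_⇔?_ : {A B : Set} → Dec A → Dec B → Dec (A ⇔ B)
a? ⇔? b? = map′ (λ (to , from) → mk⇔ to from) (λ a⇔b → Equivalence.to a⇔b , Equivalence.from a⇔b)
  ((a? →-dec b?) ×-dec (b? →-dec a?))

injective⇒surjective : ∀ {n} {f : Fin n → Fin n} → Injective _≡_ _≡_ f → ∀ j → ∃[ i ] f i ≡ j
injective⇒surjective {suc n} {f} injective j with any? (λ i → f i ≟ j)
... | yes hit = hit
... | no miss = ⊥-elim (<⇒notInjective {f = punchedOut} (n<1+n n) punchedOut-injective)
  where
  missed : ∀ i → j ≢ f i
  missed i j≡fi = miss (i , sym j≡fi)

  punchedOut : Fin (suc n) → Fin n
  punchedOut i = punchOut (missed i)

  punchedOut-injective : Injective _≡_ _≡_ punchedOut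
  punchedOut-injective {x} {y} eq = injective (punchOut-injective (missed x) (missed y) eq)

Table : Set → Set → Set
Table A B = List (A × B)

table : {A B : Set} → (A → B) → List A → Table A B
table f = map (λ x → x , f x)

module _ {A B : Set} {f : A → B} {xs : List A} where

  All-table : {P : A × B → Set} → All P (table f xs) → ∀ {x} → x ∈ xs → P (x , f x)
  All-table all x∈xs = All.lookup all (∈-map⁺ (λ x → x , f x) x∈xs)

  All²-table : {R : A × B → A × B → Set} → All (λ p → All (R p) (table f xs)) (table f xs) →
               ∀ {x y} → x ∈ xs → y ∈ xs → R (x , f x) (y , f y)
  All²-table all x∈xs y∈xs = All-table (All-table all x∈xs) y∈xs

-- Tables are extended one entry at a time, so inconsistent partial tables are discarded early.
module Tables {A B : Set} (values : List B)
  {Admissible : A × B → Set} (admissible? : ∀ p → Dec (Admissible p))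
  {Compatible : A × B → A × B → Set} (compatible? : ∀ p q → Dec (Compatible p q)) where

  Extends : Table A B → A × B → Set
  Extends t p = Admissible p × All (Compatible p) t

  extends? : ∀ t p → Dec (Extends t p)
  extends? t p = admissible? p ×-dec All.all? (compatible? p) t

  consistent : List A → List (Table A B)
  consistent [] = [ [] ]
  consistent (x ∷ xs) =
    concatMap (λ t → map (_∷ t) (filter (extends? t) (map (x ,_) values))) (consistent xs)

  table∈consistent : (f : A → B) → (∀ x → f x ∈ values) → (∀ x → Admissible (x , f x)) →
    (∀ x y → Compatible (x , f x) (y , f y)) → ∀ xs → table f xs ∈ consistent xs
  table∈consistent f f∈values admissible compatible [] = here refl
  table∈consistent f f∈values admissible compatible (x ∷ xs) =
    ∈-concatMap⁺ _ (Any.map (λ { refl → ∈-map⁺ (_∷ table f xs) extension })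
                            (table∈consistent f f∈values admissible compatible xs))
    where
    extension : (x , f x) ∈ filter (extends? (table f xs)) (map (x ,_) values)
    extension = ∈-filter⁺ (extends? (table f xs)) (∈-map⁺ (x ,_) (f∈values x))
                  (admissible x , map⁺ (All.universal (compatible x) xs))

_≟ᵥ_ : DecidableEquality Vertex
_≟ᵥ_ = ≡-dec _≟_ _≟_

∈-allVertices : ∀ v → v ∈ allVertices
∈-allVertices (x , y) = ∈-cartesianProduct⁺ (∈-allFin x) (∈-allFin y)

∀-vertex? : {P : Vertex → Set} → (∀ v → Dec (P v)) → Dec (∀ v → P v)
∀-vertex? P? = map′ (λ all (x , y) → all x y) (λ all x y → all (x , y))
  (all? λ x → all? λ y → P? (x , y))

∃-vertex? : {P : Vertex → Set} → (∀ v → Dec (P v)) → Dec (∃[ v ] P v)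
∃-vertex? P? = map′ (λ (x , y , p) → (x , y) , p) (λ ((x , y) , p) → x , y , p)
  (any? λ x → any? λ y → P? (x , y))

adjacent? : ∀ x y → Dec (Adj x y)
adjacent? (x₁ , x₂) (y₁ , y₂) = _∈?_ _≟ᵥ_ (y₁ ⊖ x₁ , y₂ ⊖ x₂) ConnSet

dist2? : ∀ x y → Dec (Dist2 x y)
dist2? x y =
  ¬? (x ≟ᵥ y) ×-dec ¬? (adjacent? x y) ×-dec ∃-vertex? λ z → adjacent? x z ×-dec adjacent? z y

ProperColouring : (Vertex → Fin 4) → Set
ProperColouring U = ∀ x y → Adj x y → U x ≢ U y

SameClasses : (Vertex → Fin 4) → (Vertex → Fin 4) → Set
SameClasses U V = ∀ x y → U x ≡ U y ⇔ V x ≡ V y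

classTable : Fin 10 → Vec (Vec (Fin 4) 4) 4
classTable 0F =
    (0F ∷ 1F ∷ 0F ∷ 1F ∷ [])
  ∷ (2F ∷ 3F ∷ 2F ∷ 3F ∷ [])
  ∷ (0F ∷ 1F ∷ 0F ∷ 1F ∷ [])
  ∷ (2F ∷ 3F ∷ 2F ∷ 3F ∷ [])
  ∷ []
classTable 1F =
    (0F ∷ 1F ∷ 0F ∷ 1F ∷ [])
  ∷ (2F ∷ 3F ∷ 2F ∷ 3F ∷ [])
  ∷ (0F ∷ 1F ∷ 0F ∷ 1F ∷ [])
  ∷ (3F ∷ 2F ∷ 3F ∷ 2F ∷ [])
  ∷ []
classTable 2F =
    (0F ∷ 1F ∷ 0F ∷ 2F ∷ [])
  ∷ (1F ∷ 3F ∷ 2F ∷ 3F ∷ [])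
  ∷ (0F ∷ 2F ∷ 0F ∷ 1F ∷ [])
  ∷ (2F ∷ 3F ∷ 1F ∷ 3F ∷ [])
  ∷ []
classTable 3F =
    (0F ∷ 1F ∷ 0F ∷ 2F ∷ [])
  ∷ (3F ∷ 2F ∷ 3F ∷ 1F ∷ [])
  ∷ (0F ∷ 1F ∷ 0F ∷ 2F ∷ [])
  ∷ (3F ∷ 2F ∷ 3F ∷ 1F ∷ [])
  ∷ []
classTable 4F =
    (0F ∷ 1F ∷ 0F ∷ 1F ∷ [])
  ∷ (2F ∷ 3F ∷ 2F ∷ 3F ∷ [])
  ∷ (1F ∷ 0F ∷ 1F ∷ 0F ∷ [])
  ∷ (2F ∷ 3F ∷ 2F ∷ 3F ∷ [])
  ∷ []
classTable 5F =
    (0F ∷ 1F ∷ 0F ∷ 1F ∷ [])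
  ∷ (2F ∷ 3F ∷ 2F ∷ 3F ∷ [])
  ∷ (1F ∷ 0F ∷ 1F ∷ 0F ∷ [])
  ∷ (3F ∷ 2F ∷ 3F ∷ 2F ∷ [])
  ∷ []
classTable 6F =
    (0F ∷ 1F ∷ 2F ∷ 1F ∷ [])
  ∷ (2F ∷ 3F ∷ 0F ∷ 3F ∷ [])
  ∷ (0F ∷ 1F ∷ 2F ∷ 1F ∷ [])
  ∷ (2F ∷ 3F ∷ 0F ∷ 3F ∷ [])
  ∷ []
classTable 7F =
    (0F ∷ 1F ∷ 2F ∷ 3F ∷ [])
  ∷ (2F ∷ 3F ∷ 0F ∷ 1F ∷ [])
  ∷ (0F ∷ 1F ∷ 2F ∷ 3F ∷ [])
  ∷ (2F ∷ 3F ∷ 0F ∷ 1F ∷ [])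
  ∷ []
classTable 8F =
    (0F ∷ 1F ∷ 2F ∷ 1F ∷ [])
  ∷ (3F ∷ 2F ∷ 3F ∷ 0F ∷ [])
  ∷ (2F ∷ 1F ∷ 0F ∷ 1F ∷ [])
  ∷ (3F ∷ 0F ∷ 3F ∷ 2F ∷ [])
  ∷ []
classTable 9F =
    (0F ∷ 1F ∷ 2F ∷ 3F ∷ [])
  ∷ (1F ∷ 2F ∷ 3F ∷ 0F ∷ [])
  ∷ (2F ∷ 3F ∷ 0F ∷ 1F ∷ [])
  ∷ (3F ∷ 0F ∷ 1F ∷ 2F ∷ [])
  ∷ []

partition : Fin 10 → Vertex → Fin 4
partition k (x , y) = lookup (lookup (classTable k) x) y

module Colourings = Tables (allFin 4) (λ _ → yes tt)
  (λ (x , c) (y , d) → adjacent? x y →-dec ¬? (c ≟ d))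

Induces : Fin 10 → Table Vertex (Fin 4) → Set
Induces k t = All (λ (x , c) → All (λ (y , d) → c ≡ d ⇔ partition k x ≡ partition k y) t) t

induces? : ∀ k t → Dec (Induces k t)
induces? k t =
  All.all? (λ (x , c) → All.all? (λ (y , d) → (c ≟ d) ⇔? (partition k x ≟ partition k y)) t) t

colourings-classified? : Dec (All (λ t → ∃[ k ] Induces k t) (Colourings.consistent allVertices))
colourings-classified? =
  All.all? (λ t → any? λ k → induces? k t) (Colourings.consistent allVertices)

-- Opaque, so that the type checker never unfolds the witnesses computed by `byEvaluation`.
opaque
  colourings-classified : All (λ t → ∃[ k ] Induces k t) (Colourings.consistent allVertices)
  colourings-classified = byEvaluation colourings-classified? refl

properColouring⇒sameClasses : ∀ U → ProperColouring U → ∃[ k ] SameClasses U (partition k)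
properColouring⇒sameClasses U proper =
  proj₁ found , λ x y → All²-table (proj₂ found) (∈-allVertices x) (∈-allVertices y)
  where
  found : ∃[ k ] Induces k (table U allVertices)
  found = All.lookup colourings-classified
    (Colourings.table∈consistent U (∈-allFin ∘ U) (λ _ → tt) proper allVertices)

record Affine : Set where
  constructor affine
  field
    a b c d : Fin 4
    shift : Vertex

apply : Affine → Vertex → Vertex
apply (affine a b c d (t₁ , t₂)) (x , y) = row a b t₁ , row c d t₂
  where
  row : Fin 4 → Fin 4 → Fin 4 → Fin 4
  row p q t = (toℕ p * toℕ x + toℕ q * toℕ y + toℕ t) mod 4

τ-affine : Fin 10 → Fin 3 → Affine
τ-affine 0F 0F = affine 1F 0F 0F 1F (0F , 2F)
τ-affine 0F 1F = affine 1F 0F 0F 1F (2F , 0F)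
τ-affine 0F 2F = affine 1F 0F 0F 1F (2F , 2F)
τ-affine 1F 0F = affine 1F 0F 0F 1F (0F , 2F)
τ-affine 1F 1F = affine 1F 0F 1F 3F (2F , 0F)
τ-affine 1F 2F = affine 1F 0F 1F 3F (2F , 2F)
τ-affine 2F 0F = affine 0F 3F 3F 0F (0F , 2F)
τ-affine 2F 1F = affine 0F 3F 3F 0F (2F , 0F)
τ-affine 2F 2F = affine 1F 0F 0F 1F (2F , 2F)
τ-affine 3F 0F = affine 1F 0F 0F 1F (2F , 0F)
τ-affine 3F 1F = affine 3F 1F 0F 1F (0F , 2F)
τ-affine 3F 2F = affine 3F 1F 0F 1F (2F , 2F)
τ-affine 4F 0F = affine 1F 0F 0F 1F (0F , 2F)
τ-affine 4F 1F = affine 1F 0F 1F 3F (2F , 1F)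
τ-affine 4F 2F = affine 1F 0F 1F 3F (2F , 3F)
τ-affine 5F 0F = affine 1F 0F 0F 1F (0F , 2F)
τ-affine 5F 1F = affine 1F 0F 0F 1F (2F , 1F)
τ-affine 5F 2F = affine 1F 0F 0F 1F (2F , 3F)
τ-affine 6F 0F = affine 1F 0F 0F 1F (2F , 0F)
τ-affine 6F 1F = affine 3F 1F 0F 1F (1F , 2F)
τ-affine 6F 2F = affine 3F 1F 0F 1F (3F , 2F)
τ-affine 7F 0F = affine 1F 0F 0F 1F (1F , 2F)
τ-affine 7F 1F = affine 1F 0F 0F 1F (2F , 0F)
τ-affine 7F 2F = affine 1F 0F 0F 1F (3F , 2F)
τ-affine 8F 0F = affine 0F 3F 3F 0F (1F , 3F)
τ-affine 8F 1F = affine 0F 3F 3F 0F (3F , 1F)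
τ-affine 8F 2F = affine 1F 0F 0F 1F (2F , 2F)
τ-affine 9F 0F = affine 1F 0F 0F 1F (1F , 3F)
τ-affine 9F 1F = affine 1F 0F 0F 1F (2F , 2F)
τ-affine 9F 2F = affine 1F 0F 0F 1F (3F , 1F)

IsAutomorphism : (Vertex → Vertex) → Set
IsAutomorphism f =
  (∀ x y → f x ≡ f y → x ≡ y) × StrictlySurjective _≡_ f × (∀ x y → Adj x y ⇔ Adj (f x) (f y))

isAutomorphism? : ∀ f → Dec (IsAutomorphism f)
isAutomorphism? f =
  (∀-vertex? λ x → ∀-vertex? λ y → f x ≟ᵥ f y →-dec x ≟ᵥ y) ×-dec
  (∀-vertex? λ y → ∃-vertex? λ x → f x ≟ᵥ y) ×-dec
  (∀-vertex? λ x → ∀-vertex? λ y → adjacent? x y ⇔? adjacent? (f x) (f y))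

toAut : ∀ f → IsAutomorphism f → Aut
toAut f (injective , surjective , preserves) = record
  { fun = f
  ; bijective = (λ {x} {y} → injective x y) , strictlySurjective⇒surjective surjective
  ; preserves = preserves
  }

τ-automorphism? : Dec (∀ k j → IsAutomorphism (apply (τ-affine k j)))
τ-automorphism? = all? λ k → all? λ j → isAutomorphism? (apply (τ-affine k j))

opaque
  τ-automorphism : ∀ k j → IsAutomorphism (apply (τ-affine k j))
  τ-automorphism = byEvaluation τ-automorphism? refl

τ : Fin 10 → Fin 3 → Aut
τ k j = toAut (apply (τ-affine k j)) (τ-automorphism k j)

good? : ∀ V σ → Dec (Good V σ)
good? V σ = all? λ i → ∀-vertex? λ s →
  V (fun (σ i) s) ≟ V s ×-dec dist2? (fun (σ i) s) s ×-dec
  all? λ i' → ¬? (i' ≟ i) →-dec dist2? (fun (σ i) s) (fun (σ i') s)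

τ-good? : Dec (∀ k → Good (partition k) (τ k))
τ-good? = all? λ k → good? (partition k) (τ k)

opaque
  τ-good : ∀ k → Good (partition k) (τ k)
  τ-good = byEvaluation τ-good? refl

ClassDerangement : (Vertex → Fin 4) → (Vertex → Vertex) → Set
ClassDerangement V f = ∀ s → V (f s) ≡ V s × f s ≢ s

module Derangements (k : Fin 10) = Tables allVertices
  (λ (s , t) → partition k t ≟ partition k s ×-dec ¬? (t ≟ᵥ s))
  (λ (x , x') (y , y') → adjacent? x y ⇔? adjacent? x' y')

Matches : Aut → Table Vertex Vertex → Set
Matches σ t = All (λ (x , y) → fun σ x ≡ y) t

matches? : ∀ σ t → Dec (Matches σ t)
matches? σ t = All.all? (λ (x , y) → fun σ x ≟ᵥ y) t

derangements-match-τ? :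
  Dec (∀ k → All (λ t → ∃[ j ] Matches (τ k j) t) (Derangements.consistent k allVertices))
derangements-match-τ? = all? λ k →
  All.all? (λ t → any? λ j → matches? (τ k j) t) (Derangements.consistent k allVertices)

opaque
  derangements-match-τ :
    ∀ k → All (λ t → ∃[ j ] Matches (τ k j) t) (Derangements.consistent k allVertices)
  derangements-match-τ = byEvaluation derangements-match-τ? refl

classDerangement⇒≗τ : ∀ k f → (∀ x y → Adj x y ⇔ Adj (f x) (f y)) →
  ClassDerangement (partition k) f → ∃[ j ] f ≗ fun (τ k j)
classDerangement⇒≗τ k f preserves deranges =
  proj₁ found , λ x → sym (All-table {f = f} (proj₂ found) (∈-allVertices x))
  where
  found : ∃[ j ] Matches (τ k j) (table f allVertices)
  found = All.lookup (derangements-match-τ k)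
    (Derangements.table∈consistent k f (∈-allVertices ∘ f) deranges preserves allVertices)

Good-transport : ∀ {U V σ} → SameClasses U V → Good V σ → Good U σ
Good-transport same good i s =
  let preserved , dist2 , apart = good i s in Equivalence.from (same _ _) preserved , dist2 , apart

Good⇒ClassDerangement : ∀ {U V σ} → SameClasses U V → Good U σ →
  ∀ i → ClassDerangement V (fun (σ i))
Good⇒ClassDerangement same good i s =
  let preserved , (moved , _) , _ = good i s in Equivalence.to (same _ _) preserved , moved

Good⇒injective : ∀ {U σ} → Good U σ → ∀ {i i'} → fun (σ i) ≗ fun (σ i') → i ≡ i'
Good⇒injective good {i} {i'} σi≗σi' with i' ≟ i
... | yes i'≡i = sym i'≡i
... | no i'≢i = let _ , _ , apart = good i origin in ⊥-elim (proj₁ (apart i' i'≢i) (σi≗σi' origin))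
  where
  origin : Vertex
  origin = 0F , 0F

matching⇒SameSet : (σ τ : Fin 3 → Aut) (g : Fin 3 → Fin 3) → (∀ i → fun (σ i) ≗ fun (τ (g i))) →
  Injective _≡_ _≡_ g → SameSet σ τ
matching⇒SameSet σ τ g match g-injective = (λ i → g i , match i) , λ j →
  let i , gi≡j = injective⇒surjective g-injective j
  in i , λ s → sym (trans (match i s) (cong (λ j → fun (τ j) s) gi≡j))

sameClasses⇒unique : ∀ {U} k → SameClasses U (partition k) → ∀ σ → Good U σ → SameSet σ (τ k)
sameClasses⇒unique k sameClasses σ good = matching⇒SameSet σ (τ k) g (proj₂ ∘ match) g-injective
  where
  open ≡-Reasoning

  match : ∀ i → ∃[ j ] fun (σ i) ≗ fun (τ k j)
  match i = classDerangement⇒≗τ k (fun (σ i)) (preserves (σ i))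
    (Good⇒ClassDerangement {σ = σ} sameClasses good i)

  g : Fin 3 → Fin 3
  g = proj₁ ∘ match

  g-injective : Injective _≡_ _≡_ g
  g-injective {i} {i'} gi≡gi' = Good⇒injective {σ = σ} good λ s → begin
    fun (σ i) s        ≡⟨ proj₂ (match i) s ⟩
    fun (τ k (g i)) s  ≡⟨ cong (λ j → fun (τ k j) s) gi≡gi' ⟩
    fun (τ k (g i')) s ≡⟨ proj₂ (match i') s ⟨
    fun (σ i') s       ∎

lemma13 : (U : Vertex → Fin 4) → IsCocliquePartition U →
    ∃[ τ ] (Good U τ × (∀ σ → Good U σ → SameSet σ τ))
lemma13 U cocliques =
  τ k , Good-transport {σ = τ k} sameClasses (τ-good k) , sameClasses⇒unique k sameClasses
  where
  proper : ProperColouring U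
  proper x y adjacent Ux≡Uy = proj₁ (cocliques (U x)) x y refl (sym Ux≡Uy) adjacent

  classified : ∃[ k ] SameClasses U (partition k)
  classified = properColouring⇒sameClasses U proper

  k : Fin 10
  k = proj₁ classified

  sameClasses : SameClasses U (partition k)
  sameClasses = proj₂ classified
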